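{- For integers $k,l\ge 2$, let $$\phi_\times(k,l)=\min\{\Gamma(G\times H)\},$$ where the minimum is over all finite connected simple graphs $G,H$, each with at least two vertices, such that $\Gamma(G)=k$ and $\Gamma(H)=l$. Then $\phi_\times(k,2)=k$ for every integer $k\ge 2$, and $\phi_\times(3,3)=4$.
   Context: The direct product $G\times H$ has vertex set $V(G)\times V(H)$, and $(a,x)(b,y)$ is an edge iff $ab\in E(G)$ and $xy\in E(H)$. A greedy $k$-colouring of a graph is a partition of its vertex set into $k$ nonempty stable sets $S_1,\dots,S_k$ such that for every $j<i$, every vertex of $S_i$ has a neighbour in $S_j$. The Grundy number $\Gamma$ is the largest such $k$. -}

module Defs where

open import Data.Nat using (ℕ; _≤_; _≥_)
open import Data.Fin using (Fin; _<_)
open import Data.Product using (Σ; ∃; _×_; _,_; proj₁; proj₂)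
open import Relation.Binary.PropositionalEquality using (_≡_)
open import Relation.Nullary using (¬_)

record Graph : Set₁ where
  field
    n     : ℕ
    Adj   : Fin n → Fin n → Set
    sym   : ∀ {u v} → Adj u v → Adj v u
    irref : ∀ {v} → ¬ Adj v v
open Graph public

data Walk (G : Graph) : Fin (n G) → Fin (n G) → Set where
  here : ∀ {u} → Walk G u u
  step : ∀ {u v w} → Adj G u v → Walk G v w → Walk G u w

Connected : Graph → Set
Connected G = ∀ u v → Walk G u v

_×ᴳ_ : Graph → Graph → Σ Set (λ V → V → V → Set)
G ×ᴳ H = (Fin (n G) × Fin (n H)) ,
         λ p q → Adj G (proj₁ p) (proj₁ q) × Adj H (proj₂ p) (proj₂ q)

record GreedyColouring {V : Set} (E : V → V → Set) (k : ℕ) : Set where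
  field
    col      : V → Fin k
    nonempty : ∀ (i : Fin k) → ∃ λ v → col v ≡ i
    stable   : ∀ {u v} → E u v → ¬ (col u ≡ col v)
    greedy   : ∀ v (j : Fin k) → j < col v → ∃ λ u → E v u × col u ≡ j

IsGrundy : {V : Set} → (V → V → Set) → ℕ → Set
IsGrundy E k = GreedyColouring E k × (∀ m → GreedyColouring E m → m ≤ k)

GrundyG : Graph → ℕ → Set
GrundyG G k = IsGrundy (Adj G) k

GrundyProd : Graph → Graph → ℕ → Set
GrundyProd G H k = IsGrundy (proj₂ (G ×ᴳ H)) k

Admissible : ℕ → ℕ → Graph → Graph → Set
Admissible k l G H =
  Connected G × Connected H × n G ≥ 2 × n H ≥ 2 × GrundyG G k × GrundyG H l

PhiTimes : ℕ → ℕ → ℕ → Set₁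
PhiTimes k l m =
  (Σ Graph λ G → Σ Graph λ H → Admissible k l G H × GrundyProd G H m)
  × (∀ G H → Admissible k l G H → ∀ m' → GrundyProd G H m' → m ≤ m')

module Submission where

-- A greedy colouring of G lifts to G × H along the first projection as soon as H
-- has no isolated vertex, so Γ(G × H) ≥ Γ(G). If G has no isolated vertex and H has a greedy
-- colouring with an edge b c whose ends have non-zero colours, give (v , x) the colour 0 when x
-- has colour 0 and 1 + colour(v) otherwise. On the vertices (v , x) with x of colour 0 or
-- x ∈ {b , c} this is a partial greedy colouring with one colour more than G's, and first-fit
-- extends it to all of G × H; hence Γ(G × H) > Γ(G) whenever Γ(H) ≥ 3. For G = H = P₄ that set
-- is already everything.
--
-- A vertex of colour c sees c distinct colours among its neighbours, so its degree
-- is at least c. This gives Γ(K_k × K₂) ≤ k and Γ(P₄) ≤ 3. In P₄ × P₄ a vertex v of colour 4 has a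
-- neighbour u of colour 3, which has a neighbour w of colour 2; w also sees u, so v and w both
-- have degree ≥ 3 and lie in {1,2}², but no vertex of P₄ × P₄ has two neighbours there.

open import Data.Empty using (⊥; ⊥-elim)
open import Data.Fin using (Fin; zero; suc; toℕ; fromℕ; fromℕ<; inject₁; punchIn; punchOut; combine; remQuot)
open import Data.Fin.Patterns using (0F; 1F; 2F; 3F)
open import Data.Fin.Properties
  using (_≟_; toℕ-injective; toℕ<n; toℕ-fromℕ; toℕ-fromℕ<; toℕ-inject; <⇒≢; injective⇒≤;
         punchIn-punchOut; remQuot-combine; ¬∀⟶∃¬-smallest)
open import Data.List using (List; []; _∷_; allFin; cartesianProduct)
open import Data.List.Membership.Propositional using (_∈_; find; lose)
open import Data.List.Membership.Propositional.Properties using (∈-allFin; ∈-cartesianProduct⁺)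
import Data.List.Relation.Unary.Any as Any
open import Data.Maybe using (Maybe; just; nothing)
import Data.Maybe.Properties as Maybe
open import Data.Nat using (ℕ; zero; suc; _*_; _≤_; _<_; _≥_; z≤n; s≤s; _≤?_; _<?_)
open import Data.Nat.Properties
  using (≤-refl; ≤-trans; ≤-reflexive; <-irrefl; <-trans; <-≤-trans; ≤⇒≯; ≮⇒≥; ≤-pred; n≤1+n;
         m≤n⇒m<n∨m≡n; n≢0⇒n>0; suc-injective; *-identityˡ; *-identityʳ)
import Data.Nat as Nat
open import Data.Product using (Σ; ∃; _×_; _,_; proj₁; proj₂)
import Data.Product as Product
open import Data.Product.Properties using (≡-dec)
open import Data.Sum using (_⊎_; inj₁; inj₂; [_,_])
open import Data.Unit using (⊤; tt)
open import Data.Vec using ([]; _∷_; lookup)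
open import Function using (_∘_; id)
open import Function.Definitions using (Injective)
open import Relation.Binary.Definitions using (DecidableEquality)
open import Relation.Binary.PropositionalEquality
  using (_≡_; _≢_; refl; sym; trans; cong; cong₂; subst; subst₂; ≢-sym; module ≡-Reasoning)
open import Relation.Nullary using (¬_; Dec; yes; no; contradiction)
open import Relation.Nullary.Decidable using (map′; decidable-stable; ¬¬-excluded-middle; _×-dec_; _⊎-dec_)
open import Relation.Nullary.Negation using (¬¬-map)

open import Defs renaming (sym to Adj-sym)

_++ʷ_ : ∀ {G u v w} → Walk G u v → Walk G v w → Walk G u w
here ++ʷ q = q
step e p ++ʷ q = step e (p ++ʷ q)

reverseʷ : ∀ {G u v} → Walk G u v → Walk G v u
reverseʷ here = here
reverseʷ {G} (step e p) = reverseʷ p ++ʷ step (Adj-sym G e) here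

connected-if-all-reach : ∀ G (r : Fin (n G)) → (∀ u → Walk G u r) → Connected G
connected-if-all-reach G r reach u v = reach u ++ʷ reverseʷ (reach v)

another-vertex : ∀ {N} → 2 ≤ N → (v : Fin N) → ∃ λ u → v ≢ u
another-vertex (s≤s (s≤s _)) zero = 1F , λ ()
another-vertex (s≤s (s≤s _)) (suc _) = 0F , λ ()

no-isolated-vertex : ∀ G → Connected G → 2 ≤ n G → ∀ v → ∃ (Adj G v)
no-isolated-vertex G connected 2≤n v with another-vertex 2≤n v
... | u , v≢u = first-step (connected v u) v≢u
  where
  first-step : ∀ {u} → Walk G v u → v ≢ u → ∃ (Adj G v)
  first-step here v≢v = ⊥-elim (v≢v refl)
  first-step (step e _) _ = _ , e

-- Degrees and greedy colourings

Degree≤ : {V : Set} → (V → V → Set) → V → ℕ → Set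
Degree≤ {V} E v d = Σ (Fin d → V) λ f → ∀ {u} → E v u → ∃ λ i → f i ≡ u

×-degree≤ : ∀ {G H a x d e} → Degree≤ (Adj G) a d → Degree≤ (Adj H) x e →
            Degree≤ (proj₂ (G ×ᴳ H)) (a , x) (d * e)
×-degree≤ {G} {H} {a} {x} {e = e} (f , f-onto) (g , g-onto) = Product.map f g ∘ remQuot e , onto
  where
  onto : ∀ {u} → proj₂ (G ×ᴳ H) (a , x) u → ∃ λ i → Product.map f g (remQuot e i) ≡ u
  onto (au , xu) with f-onto au | g-onto xu
  ... | i , fi | j , gj =
    combine i j , trans (cong (Product.map f g) (remQuot-combine i j)) (cong₂ _,_ fi gj)

distinct-neighbour-colours≤degree :
  ∀ {V : Set} {E : V → V → Set} {v d k} → Degree≤ E v d → (κ : V → ℕ) (g : Fin k → ℕ) →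
  Injective _≡_ _≡_ g → (∀ i → ∃ λ u → E v u × κ u ≡ g i) → k ≤ d
distinct-neighbour-colours≤degree (f , f-onto) κ g g-injective witness = injective⇒≤ slot-injective
  where
  slot : ∀ i → ∃ λ s → f s ≡ proj₁ (witness i)
  slot i = f-onto (proj₁ (proj₂ (witness i)))

  slot-injective : Injective _≡_ _≡_ (proj₁ ∘ slot)
  slot-injective {i} {j} same-slot = g-injective (begin
    g i                    ≡⟨ sym (proj₂ (proj₂ (witness i))) ⟩
    κ (proj₁ (witness i))  ≡⟨ cong κ (trans (sym (proj₂ (slot i))) (trans (cong f same-slot) (proj₂ (slot j)))) ⟩
    κ (proj₁ (witness j))  ≡⟨ proj₂ (proj₂ (witness j)) ⟩
    g j                    ∎)
    where open ≡-Reasoning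

module GreedyFacts {V : Set} {E : V → V → Set} {m : ℕ} (γ : GreedyColouring E m) where
  open GreedyColouring γ

  colour : V → ℕ
  colour = toℕ ∘ col

  neighbour-of-colour : ∀ v {j} → j < colour v → ∃ λ u → E v u × colour u ≡ j
  neighbour-of-colour v {j} j<cv =
    Product.map₂ (Product.map₂ λ cu → trans (cong toℕ cu) (toℕ-fromℕ< j<m)) found
    where
    j<m : j < m
    j<m = <-trans j<cv (toℕ<n (col v))
    found : ∃ λ u → E v u × col u ≡ fromℕ< j<m
    found = greedy v (fromℕ< j<m) (subst (_< colour v) (sym (toℕ-fromℕ< j<m)) j<cv)

  colour≤degree : ∀ {v d} → Degree≤ E v d → colour v ≤ d
  colour≤degree {v} v-degree =
    distinct-neighbour-colours≤degree {E = E} v-degree colour toℕ toℕ-injective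
      (λ i → neighbour-of-colour v (toℕ<n i))

  colour<degree : ∀ {u v d} → Degree≤ E v d → E v u → colour v < colour u → colour v < d
  colour<degree {u} {v} v-degree vu cv<cu =
    distinct-neighbour-colours≤degree {E = E} v-degree colour g g-injective witness
    where
    g : Fin (suc (colour v)) → ℕ
    g zero = colour u
    g (suc i) = toℕ i

    g-injective : Injective _≡_ _≡_ g
    g-injective {zero} {zero} _ = refl
    g-injective {zero} {suc j} cu≡j = ⊥-elim (<-irrefl (sym cu≡j) (<-trans (toℕ<n j) cv<cu))
    g-injective {suc i} {zero} i≡cu = ⊥-elim (<-irrefl i≡cu (<-trans (toℕ<n i) cv<cu))
    g-injective {suc i} {suc j} i≡j = cong suc (toℕ-injective i≡j)

    witness : ∀ i → ∃ λ w → E v w × colour w ≡ g i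
    witness zero = u , vu , refl
    witness (suc i) = neighbour-of-colour v (toℕ<n i)

  colour-unused⇒≤ : ∀ K → (∀ v → colour v ≢ K) → m ≤ K
  colour-unused⇒≤ K unused with K <? m
  ... | no K≮m = ≮⇒≥ K≮m
  ... | yes K<m with nonempty (fromℕ< K<m)
  ...   | v , cv = ⊥-elim (unused v (trans (cong toℕ cv) (toℕ-fromℕ< K<m)))

  colours≤maxDegree+1 : ∀ {D} (deg : V → ℕ) → (∀ v → Degree≤ E v (deg v)) → (∀ v → deg v ≤ D) →
                        m ≤ suc D
  colours≤maxDegree+1 deg has-degree deg≤D = colour-unused⇒≤ _ λ v cv≡1+D →
    ≤⇒≯ (≤-trans (colour≤degree (has-degree v)) (deg≤D v)) (≤-reflexive (sym cv≡1+D))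

×-lift : ∀ {G H k} → GreedyColouring (Adj G) k → (∀ x → ∃ (Adj H x)) → Fin (n H) →
         GreedyColouring (proj₂ (G ×ᴳ H)) k
×-lift γ H-no-isolated x₀ = record
  { col = col ∘ proj₁
  ; nonempty = λ i → (proj₁ (nonempty i) , x₀) , proj₂ (nonempty i)
  ; stable = stable ∘ proj₁
  ; greedy = λ (v , x) j j<cv →
      let (u , vu , cu) = greedy v j j<cv ; (y , xy) = H-no-isolated x in (u , y) , (vu , xy) , cu
  }
  where open GreedyColouring γ

×-Grundy≥left : ∀ {k l G H m} → Admissible k l G H → GrundyProd G H m → k ≤ m
×-Grundy≥left {G = G} {H} (_ , H-connected , _ , 2≤nH , (γ , _) , _) (_ , maximal) =
  maximal _ (×-lift {G} {H} γ (no-isolated-vertex H H-connected 2≤nH) x₀)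
  where
  x₀ : Fin (n H)
  x₀ = fromℕ< {0} (<-≤-trans (s≤s z≤n) 2≤nH)

-- Complete graphs

K : ℕ → Graph
K k = record { n = k ; Adj = _≢_ ; sym = ≢-sym ; irref = λ v≢v → v≢v refl }

K-connected : ∀ k → Connected (K k)
K-connected k u v with u ≟ v
... | yes refl = here
... | no u≢v = step u≢v here

K-degree≤ : ∀ {k} (a : Fin (suc k)) → Degree≤ (Adj (K (suc k))) a k
K-degree≤ a = punchIn a , λ a≢u → punchOut a≢u , punchIn-punchOut a≢u

K-Grundy : ∀ k → GrundyG (K (suc k)) (suc k)
K-Grundy k = identity , λ m γ → GreedyFacts.colours≤maxDegree+1 γ (λ _ → k) K-degree≤ (λ _ → ≤-refl)
  where
  identity : GreedyColouring (Adj (K (suc k))) (suc k)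
  identity = record
    { col = id
    ; nonempty = λ i → i , refl
    ; stable = id
    ; greedy = λ v j j<v → j , ≢-sym (<⇒≢ j<v) , refl
    }

K×K₂-Grundy : ∀ k → GrundyProd (K (suc k)) (K 2) (suc k)
K×K₂-Grundy k =
  ×-lift {K (suc k)} {K 2} (proj₁ (K-Grundy k)) (no-isolated-vertex (K 2) (K-connected 2) ≤-refl) 0F ,
  λ m γ → GreedyFacts.colours≤maxDegree+1 γ (λ _ → k * 1)
            (λ (a , x) → ×-degree≤ {K (suc k)} {K 2} (K-degree≤ a) (K-degree≤ x))
            (λ _ → ≤-reflexive (*-identityʳ k))

-- Partial greedy colourings and first-fit

module PartialColourings {V : Set} (E : V → V → Set) where

  PartialColouring : Set
  PartialColouring = V → Maybe ℕ

  record IsPartialGreedy (k : ℕ) (p : PartialColouring) : Set where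
    field
      bounded : ∀ {v a} → p v ≡ just a → a < k
      onto    : ∀ {i} → i < k → ∃ λ v → p v ≡ just i
      stable  : ∀ {u v a} → E u v → p u ≡ just a → p v ≡ just a → ⊥
      greedy  : ∀ {v a} → p v ≡ just a → ∀ {j} → j < a → ∃ λ u → E v u × p u ≡ just j

  Coloured : PartialColouring → V → Set
  Coloured p v = ∃ λ a → p v ≡ just a

  total⇒greedy : ∀ {k p} → IsPartialGreedy k p → (∀ v → Coloured p v) → GreedyColouring E k
  total⇒greedy {k} {p} P total = record
    { col = col
    ; nonempty = λ i → Product.map₂ col-exact (onto (toℕ<n i))
    ; stable = λ {u} {v} uv cu≡cv →
        stable uv (coloured u) (subst (λ a → p v ≡ just a) (sym (same-colour cu≡cv)) (coloured v))
    ; greedy = λ v j j<cv →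
        Product.map₂ (Product.map₂ col-exact) (greedy (coloured v) (subst (toℕ j <_) (toℕ-col v) j<cv))
    }
    where
    open IsPartialGreedy P

    colour : V → ℕ
    colour v = proj₁ (total v)

    coloured : ∀ v → p v ≡ just (colour v)
    coloured v = proj₂ (total v)

    col : V → Fin k
    col v = fromℕ< (bounded (coloured v))

    toℕ-col : ∀ v → toℕ (col v) ≡ colour v
    toℕ-col v = toℕ-fromℕ< _

    col-exact : ∀ {v} {i : Fin k} → p v ≡ just (toℕ i) → col v ≡ i
    col-exact {v} pv = toℕ-injective (trans (toℕ-col v) (Maybe.just-injective (trans (sym (coloured v)) pv)))

    same-colour : ∀ {u v} → col u ≡ col v → colour u ≡ colour v
    same-colour {u} {v} cu≡cv = trans (sym (toℕ-col u)) (trans (cong toℕ cu≡cv) (toℕ-col v))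

  restrict : {D : V → Set} → (∀ v → Dec (D v)) → (V → ℕ) → PartialColouring
  restrict D? c v with D? v
  ... | yes _ = just (c v)
  ... | no _ = nothing

  restrict-inside : ∀ {D} (D? : ∀ v → Dec (D v)) c {v} → D v → restrict {D} D? c v ≡ just (c v)
  restrict-inside D? c {v} v∈D with D? v
  ... | yes _ = refl
  ... | no v∉D = contradiction v∈D v∉D

  restrict-just : ∀ {D} (D? : ∀ v → Dec (D v)) c {v a} → restrict {D} D? c v ≡ just a → D v × c v ≡ a
  restrict-just D? c {v} eq with D? v
  ... | yes v∈D = v∈D , Maybe.just-injective eq

module FirstFit {V : Set} {E : V → V → Set}
  (E? : ∀ u v → Dec (E u v)) (E-sym : ∀ {u v} → E u v → E v u) (E-irrefl : ∀ {v} → ¬ E v v)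
  (_≟V_ : DecidableEquality V) (vertices : List V) (complete : ∀ v → v ∈ vertices) where

  open PartialColourings E

  search : {P : V → Set} → (∀ v → Dec (P v)) → Dec (∃ P)
  search P? = map′ (λ found → let (v , _ , pv) = find found in v , pv)
                   (λ (v , pv) → lose (complete v) pv)
                   (Any.any? P? vertices)

  _⊑_ : PartialColouring → PartialColouring → Set
  p ⊑ q = ∀ {v a} → p v ≡ just a → q v ≡ just a

  _[_≔_] : PartialColouring → V → ℕ → PartialColouring
  (p [ w ≔ c ]) v with v ≟V w
  ... | yes _ = just c
  ... | no _ = p v

  ≔-here : ∀ p w c → (p [ w ≔ c ]) w ≡ just c
  ≔-here p w c with w ≟V w
  ... | yes _ = refl
  ... | no w≢w = contradiction refl w≢w

  ≔-extends : ∀ {p w} c → p w ≡ nothing → p ⊑ (p [ w ≔ c ])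
  ≔-extends {p} {w} c pw {v} pv with v ≟V w
  ... | yes refl = contradiction (trans (sym pv) pw) λ ()
  ... | no _ = pv

  ≔-just : ∀ {p w c v a} → (p [ w ≔ c ]) v ≡ just a → (v ≡ w × c ≡ a) ⊎ p v ≡ just a
  ≔-just {w = w} {v = v} eq with v ≟V w
  ... | yes v≡w = inj₁ (v≡w , Maybe.just-injective eq)
  ... | no _ = inj₂ eq

  record Extension (k : ℕ) (p : PartialColouring) (S : V → Set) : Set where
    field
      {k′}     : ℕ
      q        : PartialColouring
      k≤k′     : k ≤ k′
      q-greedy : IsPartialGreedy k′ q
      p⊑q      : p ⊑ q
      covers   : ∀ {v} → S v → Coloured q v

  module FreshVertex {k p} (P : IsPartialGreedy k p) (w : V) (w-fresh : p w ≡ nothing) where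
    open IsPartialGreedy P

    Used : ℕ → Set
    Used c = ∃ λ u → E w u × p u ≡ just c

    used? : ∀ c → Dec (Used c)
    used? c = search λ u → E? w u ×-dec Maybe.≡-dec Nat._≟_ (p u) (just c)

    k-unused : ¬ Used k
    k-unused (_ , _ , pu) = <-irrefl refl (bounded pu)

    least-unused : ∃ λ c → c ≤ k × ¬ Used c × (∀ {j} → j < c → Used j)
    least-unused with ¬∀⟶∃¬-smallest (suc k) (Used ∘ toℕ) (used? ∘ toℕ)
                        (λ all → k-unused (subst Used (toℕ-fromℕ k) (all (fromℕ k))))
    ... | c , c-unused , below = toℕ c , ≤-pred (toℕ<n c) , c-unused ,
          λ j<c → subst Used (trans (toℕ-inject _) (toℕ-fromℕ< j<c)) (below (fromℕ< j<c))

    module Colour {c} (c≤k : c ≤ k) (c-unused : ¬ Used c) (below-used : ∀ {j} → j < c → Used j) where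

      p′ : PartialColouring
      p′ = p [ w ≔ c ]

      p⊑p′ : p ⊑ p′
      p⊑p′ = ≔-extends c w-fresh

      p′-stable : ∀ {u v a} → E u v → p′ u ≡ just a → p′ v ≡ just a → ⊥
      p′-stable uv pu pv with ≔-just pu | ≔-just pv
      ... | inj₁ (refl , _)    | inj₁ (refl , _)    = E-irrefl uv
      ... | inj₁ (refl , refl) | inj₂ pv′           = c-unused (_ , uv , pv′)
      ... | inj₂ pu′           | inj₁ (refl , refl) = c-unused (_ , E-sym uv , pu′)
      ... | inj₂ pu′           | inj₂ pv′           = stable uv pu′ pv′

      p′-greedy : ∀ {v a} → p′ v ≡ just a → ∀ {j} → j < a → ∃ λ u → E v u × p′ u ≡ just j
      p′-greedy pv j<a with ≔-just pv
      ... | inj₁ (refl , refl) = Product.map₂ (Product.map₂ p⊑p′) (below-used j<a)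
      ... | inj₂ pv′ = Product.map₂ (Product.map₂ p⊑p′) (greedy pv′ j<a)

      p′-partial-greedy : ∀ {k′} → c < k′ → k ≤ k′ → (∀ {i} → i < k′ → ∃ λ v → p′ v ≡ just i) →
                          IsPartialGreedy k′ p′
      p′-partial-greedy c<k′ k≤k′ onto′ = record
        { bounded = λ pv → [ (λ (_ , c≡a) → subst (_< _) c≡a c<k′)
                           , (λ pv′ → <-≤-trans (bounded pv′) k≤k′) ] (≔-just pv)
        ; onto = onto′
        ; stable = p′-stable
        ; greedy = p′-greedy
        }

      extension : Extension k p (_≡ w)
      extension with m≤n⇒m<n∨m≡n c≤k
      ... | inj₁ c<k = record
        { q = p′ ; k≤k′ = ≤-refl ; q-greedy = p′-partial-greedy c<k ≤-refl (Product.map₂ p⊑p′ ∘ onto)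
        ; p⊑q = p⊑p′ ; covers = λ { refl → c , ≔-here p w c } }
      ... | inj₂ c≡k = record
        { q = p′ ; k≤k′ = n≤1+n k ; q-greedy = p′-partial-greedy (s≤s (≤-reflexive c≡k)) (n≤1+n k) onto′
        ; p⊑q = p⊑p′ ; covers = λ { refl → c , ≔-here p w c } }
        where
        onto′ : ∀ {i} → i < suc k → ∃ λ v → p′ v ≡ just i
        onto′ i<1+k with m≤n⇒m<n∨m≡n (≤-pred i<1+k)
        ... | inj₁ i<k = Product.map₂ p⊑p′ (onto i<k)
        ... | inj₂ refl = w , trans (≔-here p w c) (cong just c≡k)

    extension : Extension k p (_≡ w)
    extension with least-unused
    ... | _ , c≤k , c-unused , below-used = Colour.extension c≤k c-unused below-used

  colour-vertex : ∀ {k p} → IsPartialGreedy k p → ∀ w → Extension k p (_≡ w)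
  colour-vertex {k} {p} P w with p w in pw
  ... | just a =
    record { q = p ; k≤k′ = ≤-refl ; q-greedy = P ; p⊑q = id ; covers = λ { refl → a , pw } }
  ... | nothing = FreshVertex.extension P w pw

  colour-all : ∀ {k p} → IsPartialGreedy k p → ∀ xs → Extension k p (_∈ xs)
  colour-all P [] = record { q = _ ; k≤k′ = ≤-refl ; q-greedy = P ; p⊑q = id ; covers = λ () }
  colour-all P (x ∷ xs) = record
    { q = q rest
    ; k≤k′ = ≤-trans (k≤k′ first) (k≤k′ rest)
    ; q-greedy = q-greedy rest
    ; p⊑q = p⊑q rest ∘ p⊑q first
    ; covers = λ { (Any.here refl) → Product.map₂ (p⊑q rest) (covers first refl)
                 ; (Any.there x∈xs) → covers rest x∈xs }
    }
    where
    open Extension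
    first = colour-vertex P x
    rest = colour-all (q-greedy first) xs

  extend : ∀ {k p} → IsPartialGreedy k p → ∃ λ k′ → k ≤ k′ × GreedyColouring E k′
  extend P = _ , k≤k′ , total⇒greedy q-greedy (λ v → covers (complete v))
    where open Extension (colour-all P vertices)

-- A product colouring with one colour more

module ProductColouring {G H : Graph} {k l : ℕ}
  (γ : GreedyColouring (Adj G) (suc k)) (δ : GreedyColouring (Adj H) (suc l))
  (G-no-isolated : ∀ v → ∃ (Adj G v))
  (A : Fin (n H) → Set) (A? : ∀ x → Dec (A x))
  (A-zero : ∀ {x} → GreedyColouring.col δ x ≡ zero → A x)
  (A-linked : ∀ {x} → A x → GreedyColouring.col δ x ≢ zero →
              ∃ λ y → Adj H x y × A y × GreedyColouring.col δ y ≢ zero)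
  (a : Fin (n H)) (a∈A : A a) (a≢zero : GreedyColouring.col δ a ≢ zero) where

  open GreedyColouring
  open PartialColourings (proj₂ (G ×ᴳ H))

  shift : Fin (suc k) → Fin (suc l) → ℕ
  shift i zero = 0
  shift i (suc _) = suc (toℕ i)

  shift-nonzero : ∀ i {s} → s ≢ zero → shift i s ≡ suc (toℕ i)
  shift-nonzero i {zero} s≢0 = contradiction refl s≢0
  shift-nonzero i {suc _} _ = refl

  shift-bounded : ∀ i s → shift i s < suc (suc k)
  shift-bounded i zero = s≤s z≤n
  shift-bounded i (suc _) = s≤s (toℕ<n i)

  shift-separates : ∀ {i i′ s s′} → i ≢ i′ → s ≢ s′ → shift i s ≢ shift i′ s′
  shift-separates {s = zero} {zero} _ s≢s′ _ = s≢s′ refl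
  shift-separates {s = zero} {suc _} _ _ ()
  shift-separates {s = suc _} {zero} _ _ ()
  shift-separates {s = suc _} {suc _} i≢i′ _ eq = i≢i′ (toℕ-injective (suc-injective eq))

  colour : Fin (n G) × Fin (n H) → ℕ
  colour (v , x) = shift (col γ v) (col δ x)

  p : PartialColouring
  p = restrict (A? ∘ proj₂) colour

  inside : ∀ {v x} → A x → p (v , x) ≡ just (colour (v , x))
  inside = restrict-inside (A? ∘ proj₂) colour

  partial-greedy : IsPartialGreedy (suc (suc k)) p
  partial-greedy = record { bounded = bounded ; onto = onto ; stable = stable′ ; greedy = greedy′ }
    where
    bounded : ∀ {v a} → p v ≡ just a → a < suc (suc k)
    bounded {v , x} pv with restrict-just (A? ∘ proj₂) colour pv
    ... | _ , refl = shift-bounded (col γ v) (col δ x)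

    onto : ∀ {i} → i < suc (suc k) → ∃ λ v → p v ≡ just i
    onto {zero} _ with nonempty δ zero
    ... | z , z-zero =
      (proj₁ (nonempty γ zero) , z) , trans (inside (A-zero z-zero)) (cong (just ∘ shift _) z-zero)
    onto {suc i} (s≤s i<1+k) with nonempty γ (fromℕ< i<1+k)
    ... | v , cv = (v , a) , trans (inside a∈A) (cong just (begin
      shift (col γ v) (col δ a)  ≡⟨ shift-nonzero _ a≢zero ⟩
      suc (toℕ (col γ v))        ≡⟨ cong (suc ∘ toℕ) cv ⟩
      suc (toℕ (fromℕ< i<1+k))   ≡⟨ cong suc (toℕ-fromℕ< i<1+k) ⟩
      suc i                      ∎))
      where open ≡-Reasoning

    stable′ : ∀ {u v a} → proj₂ (G ×ᴳ H) u v → p u ≡ just a → p v ≡ just a → ⊥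
    stable′ (vv′ , xx′) pu pv
      with restrict-just (A? ∘ proj₂) colour pu | restrict-just (A? ∘ proj₂) colour pv
    ... | _ , refl | _ , same = shift-separates (stable γ vv′) (stable δ xx′) (sym same)

    greedy′ : ∀ {v a} → p v ≡ just a → ∀ {j} → j < a → ∃ λ u → proj₂ (G ×ᴳ H) v u × p u ≡ just j
    greedy′ {v , x} pvx j<a with restrict-just (A? ∘ proj₂) colour pvx | col δ x ≟ zero
    ... | _ , refl | yes x-zero = contradiction (subst (_ <_) (cong (shift _) x-zero) j<a) λ ()
    ... | x∈A , refl | no x≢zero = below (subst (_ <_) (shift-nonzero _ x≢zero) j<a)
      where
      below : ∀ {j} → j < suc (toℕ (col γ v)) → ∃ λ u → proj₂ (G ×ᴳ H) (v , x) u × p u ≡ just j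
      below {zero} _ with G-no-isolated v | greedy δ x zero (n≢0⇒n>0 (x≢zero ∘ toℕ-injective))
      ... | v′ , vv′ | z , xz , z-zero =
        (v′ , z) , (vv′ , xz) , trans (inside (A-zero z-zero)) (cong (just ∘ shift _) z-zero)
      below {suc j} (s≤s j<cv) with GreedyFacts.neighbour-of-colour γ v j<cv | A-linked x∈A x≢zero
      ... | v′ , vv′ , cv′ | y , xy , y∈A , y≢zero =
        (v′ , y) , (vv′ , xy) ,
        trans (inside y∈A) (cong just (trans (shift-nonzero _ y≢zero) (cong suc cv′)))

  greedy-colouring : (∀ x → A x) → GreedyColouring (proj₂ (G ×ᴳ H)) (suc (suc k))
  greedy-colouring everywhere = total⇒greedy partial-greedy λ (v , x) → _ , inside (everywhere x)

¬¬-Π : ∀ {N} {P : Fin N → Set} → (∀ i → ¬ ¬ P i) → ¬ ¬ (∀ i → P i)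
¬¬-Π {zero} _ ¬all = ¬all λ ()
¬¬-Π {suc N} ¬¬P ¬all =
  ¬¬P zero λ P₀ → ¬¬-Π (¬¬P ∘ suc) λ Pₛ → ¬all λ { zero → P₀ ; (suc i) → Pₛ i }

¬¬-Adj-decidable : ∀ G → ¬ ¬ (∀ u v → Dec (Adj G u v))
¬¬-Adj-decidable G = ¬¬-Π λ u → ¬¬-Π λ v → ¬¬-excluded-middle

-- First-fit needs decidable adjacency, which the abstract graphs G and H only have up to double
-- negation; this is harmless for a decidable conclusion such as 4 ≤ m.
×-colours>left : ∀ {G H k l} → GreedyColouring (Adj G) (suc k) → (∀ v → ∃ (Adj G v)) →
                 GreedyColouring (Adj H) (suc (suc (suc l))) →
                 ¬ ¬ (∃ λ K → suc (suc k) ≤ K × GreedyColouring (proj₂ (G ×ᴳ H)) K)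
×-colours>left {G} {H} γ G-no-isolated δ ¬goal =
  ¬¬-Adj-decidable G λ G? → ¬¬-Adj-decidable H λ H? →
  ¬goal (FirstFit.extend {E = proj₂ (G ×ᴳ H)} (λ u v → G? _ _ ×-dec H? _ _)
           (λ (vv′ , xx′) → Adj-sym G vv′ , Adj-sym H xx′) (λ (vv , _) → irref G vv)
           (≡-dec _≟_ _≟_) (cartesianProduct (allFin _) (allFin _))
           (λ (v , x) → ∈-cartesianProduct⁺ (∈-allFin v) (∈-allFin x))
           partial-greedy)
  where
  open GreedyColouring δ

  c : Fin (n H)
  c = proj₁ (nonempty 2F)

  c-two : col c ≡ 2F
  c-two = proj₂ (nonempty 2F)

  b-found : ∃ λ b → Adj H c b × col b ≡ 1F
  b-found = greedy c 1F (subst (λ d → 1 < toℕ d) (sym c-two) (s≤s (s≤s z≤n)))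

  b : Fin (n H)
  b = proj₁ b-found

  b-one : col b ≡ 1F
  b-one = proj₂ (proj₂ b-found)

  nonzero : ∀ {x i} → col x ≡ suc i → col x ≢ zero
  nonzero x-suc x-zero = contradiction (trans (sym x-suc) x-zero) λ ()

  A : Fin (n H) → Set
  A x = col x ≡ zero ⊎ x ≡ b ⊎ x ≡ c

  A-linked : ∀ {x} → A x → col x ≢ zero → ∃ λ y → Adj H x y × A y × col y ≢ zero
  A-linked (inj₁ x-zero) x≢zero = contradiction x-zero x≢zero
  A-linked (inj₂ (inj₁ refl)) _ = c , Adj-sym H (proj₁ (proj₂ b-found)) , inj₂ (inj₂ refl) , nonzero c-two
  A-linked (inj₂ (inj₂ refl)) _ = b , proj₁ (proj₂ b-found) , inj₂ (inj₁ refl) , nonzero b-one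

  open ProductColouring {G} {H} γ δ G-no-isolated
         A (λ x → (col x ≟ zero) ⊎-dec (x ≟ b ⊎-dec x ≟ c)) inj₁ A-linked c (inj₂ (inj₂ refl)) (nonzero c-two)

×-Grundy[3,3]≥4 : ∀ {G H m} → Admissible 3 3 G H → GrundyProd G H m → 4 ≤ m
×-Grundy[3,3]≥4 {G} {H} (G-connected , _ , 2≤nG , _ , (γ , _) , (δ , _)) (_ , maximal) =
  decidable-stable (4 ≤? _)
    (¬¬-map (λ (K , 4≤K , colouring) → ≤-trans 4≤K (maximal K colouring))
            (×-colours>left {G} {H} γ (no-isolated-vertex G G-connected 2≤nG) δ))

-- The path P₄

data P₄-edge : Fin 4 → Fin 4 → Set where
  e01 : P₄-edge 0F 1F
  e10 : P₄-edge 1F 0F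
  e12 : P₄-edge 1F 2F
  e21 : P₄-edge 2F 1F
  e23 : P₄-edge 2F 3F
  e32 : P₄-edge 3F 2F

P₄ : Graph
P₄ = record { n = 4 ; Adj = P₄-edge ; sym = reverse ; irref = λ () }
  where
  reverse : ∀ {u v} → P₄-edge u v → P₄-edge v u
  reverse e01 = e10
  reverse e10 = e01
  reverse e12 = e21
  reverse e21 = e12
  reverse e23 = e32
  reverse e32 = e23

P₄-connected : Connected P₄
P₄-connected = connected-if-all-reach P₄ 0F to-0F
  where
  to-0F : ∀ u → Walk P₄ u 0F
  to-0F 0F = here
  to-0F 1F = step e10 here
  to-0F 2F = step e21 (step e10 here)
  to-0F 3F = step e32 (step e21 (step e10 here))

P₄-no-isolated : ∀ v → ∃ (P₄-edge v)
P₄-no-isolated = no-isolated-vertex P₄ P₄-connected (s≤s (s≤s z≤n))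

P₄-degree : Fin 4 → ℕ
P₄-degree 0F = 1
P₄-degree 1F = 2
P₄-degree 2F = 2
P₄-degree 3F = 1

P₄-degree≤ : ∀ a → Degree≤ P₄-edge a (P₄-degree a)
P₄-degree≤ 0F = (λ _ → 1F) , λ { e01 → 0F , refl }
P₄-degree≤ 1F = lookup (0F ∷ 2F ∷ []) , λ { e10 → 0F , refl ; e12 → 1F , refl }
P₄-degree≤ 2F = lookup (1F ∷ 3F ∷ []) , λ { e21 → 0F , refl ; e23 → 1F , refl }
P₄-degree≤ 3F = (λ _ → 2F) , λ { e32 → 0F , refl }

P₄-degree≤2 : ∀ a → P₄-degree a ≤ 2
P₄-degree≤2 0F = s≤s z≤n
P₄-degree≤2 1F = ≤-refl
P₄-degree≤2 2F = ≤-refl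
P₄-degree≤2 3F = s≤s z≤n

P₄-colouring : GreedyColouring P₄-edge 3
P₄-colouring = record
  { col = col ; nonempty = λ i → inject₁ i , col-inject₁ i ; stable = stable ; greedy = greedy }
  where
  col : Fin 4 → Fin 3
  col 0F = 0F
  col 1F = 1F
  col 2F = 2F
  col 3F = 0F

  col-inject₁ : ∀ i → col (inject₁ i) ≡ i
  col-inject₁ 0F = refl
  col-inject₁ 1F = refl
  col-inject₁ 2F = refl

  stable : ∀ {u v} → P₄-edge u v → col u ≢ col v
  stable e01 ()
  stable e10 ()
  stable e12 ()
  stable e21 ()
  stable e23 ()
  stable e32 ()

  greedy : ∀ v j → toℕ j < toℕ (col v) → ∃ λ u → P₄-edge v u × col u ≡ j
  greedy 0F _ ()
  greedy 1F 0F _ = 0F , e10 , refl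
  greedy 1F (suc _) (s≤s ())
  greedy 2F 0F _ = 3F , e23 , refl
  greedy 2F 1F _ = 1F , e21 , refl
  greedy 2F (suc (suc _)) (s≤s (s≤s ()))
  greedy 3F _ ()

P₄-Grundy : GrundyG P₄ 3
P₄-Grundy = P₄-colouring , λ m γ → GreedyFacts.colours≤maxDegree+1 γ P₄-degree P₄-degree≤ P₄-degree≤2

P₄×P₄-colouring : GreedyColouring (proj₂ (P₄ ×ᴳ P₄)) 4
P₄×P₄-colouring = greedy-colouring (λ _ → tt)
  where
  open GreedyColouring P₄-colouring using (col)

  linked : ∀ {x} → ⊤ → col x ≢ zero → ∃ λ y → P₄-edge x y × ⊤ × col y ≢ zero
  linked {0F} _ x≢zero = contradiction refl x≢zero
  linked {1F} _ _ = 2F , e12 , tt , λ ()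
  linked {2F} _ _ = 1F , e21 , tt , λ ()
  linked {3F} _ x≢zero = contradiction refl x≢zero

  open ProductColouring {P₄} {P₄} P₄-colouring P₄-colouring P₄-no-isolated
         (λ _ → ⊤) (λ _ → yes tt) _ linked 1F tt (λ ())

data Inner : Fin 4 → Set where
  inner₁ : Inner 1F
  inner₂ : Inner 2F

inner-or-end : ∀ a → Inner a ⊎ P₄-degree a ≡ 1
inner-or-end 0F = inj₂ refl
inner-or-end 1F = inj₁ inner₁
inner-or-end 2F = inj₁ inner₂
inner-or-end 3F = inj₂ refl

inner-of-3≤degree : ∀ {a b} → 3 ≤ P₄-degree a * P₄-degree b → Inner a × Inner b
inner-of-3≤degree {a} {b} 3≤ab with inner-or-end a | inner-or-end b
... | inj₁ a-inner | inj₁ b-inner = a-inner , b-inner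
... | inj₂ a-end | _ =
  contradiction (subst (3 ≤_) (trans (cong (_* P₄-degree b) a-end) (*-identityˡ _)) 3≤ab) (≤⇒≯ (P₄-degree≤2 b))
... | _ | inj₂ b-end =
  contradiction (subst (3 ≤_) (trans (cong (P₄-degree a *_) b-end) (*-identityʳ _)) 3≤ab) (≤⇒≯ (P₄-degree≤2 a))

inner-neighbour-unique : ∀ {a b c} → P₄-edge a b → P₄-edge a c → Inner b → Inner c → b ≡ c
inner-neighbour-unique e01 e01 _ _ = refl
inner-neighbour-unique e12 e12 _ _ = refl
inner-neighbour-unique e21 e21 _ _ = refl
inner-neighbour-unique e32 e32 _ _ = refl
inner-neighbour-unique e10 _ () _
inner-neighbour-unique e23 _ () _
inner-neighbour-unique _ e10 _ ()
inner-neighbour-unique _ e23 _ ()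

P₄×P₄-colours≤4 : ∀ {m} → GreedyColouring (proj₂ (P₄ ×ᴳ P₄)) m → m ≤ 4
P₄×P₄-colours≤4 γ = colour-unused⇒≤ 4 no-colour-4
  where
  open GreedyFacts γ

  Inner² : Fin 4 × Fin 4 → Set
  Inner² (a , b) = Inner a × Inner b

  reverse : ∀ {u v} → proj₂ (P₄ ×ᴳ P₄) u v → proj₂ (P₄ ×ᴳ P₄) v u
  reverse = Product.map (Adj-sym P₄) (Adj-sym P₄)

  has-degree : ∀ v → Degree≤ (proj₂ (P₄ ×ᴳ P₄)) v (P₄-degree (proj₁ v) * P₄-degree (proj₂ v))
  has-degree (a , b) = ×-degree≤ {P₄} {P₄} (P₄-degree≤ a) (P₄-degree≤ b)

  inner-neighbour-unique² : ∀ {u v w} → proj₂ (P₄ ×ᴳ P₄) u v → proj₂ (P₄ ×ᴳ P₄) u w →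
                            Inner² v → Inner² w → v ≡ w
  inner-neighbour-unique² (av , bv) (aw , bw) (av-inner , bv-inner) (aw-inner , bw-inner) =
    cong₂ _,_ (inner-neighbour-unique av aw av-inner aw-inner)
              (inner-neighbour-unique bv bw bv-inner bw-inner)

  no-colour-4 : ∀ v → colour v ≢ 4
  no-colour-4 v cv≡4 with neighbour-of-colour v (subst (3 <_) (sym cv≡4) ≤-refl)
  ... | u , vu , cu≡3 with neighbour-of-colour u (subst (2 <_) (sym cu≡3) ≤-refl)
  ...   | w , uw , cw≡2 = contradiction (trans (sym cv≡4) (trans (cong colour v≡w) cw≡2)) λ ()
    where
    v-inner : Inner² v
    v-inner = inner-of-3≤degree
                (≤-trans (subst (3 ≤_) (sym cv≡4) (n≤1+n 3)) (colour≤degree (has-degree v)))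

    w-inner : Inner² w
    w-inner = inner-of-3≤degree (subst (λ c → suc c ≤ _) cw≡2
                (colour<degree (has-degree w) (reverse uw) (subst₂ _<_ (sym cw≡2) (sym cu≡3) ≤-refl)))

    v≡w : v ≡ w
    v≡w = inner-neighbour-unique² (reverse vu) uw v-inner w-inner

φ×[k,2]≡k : ∀ k → k ≥ 2 → PhiTimes k 2 k
φ×[k,2]≡k (suc k) k≥2 =
  (K (suc k) , K 2 ,
   (K-connected _ , K-connected 2 , k≥2 , ≤-refl , K-Grundy k , K-Grundy 1) ,
   K×K₂-Grundy k) ,
  λ G H admissible m → ×-Grundy≥left admissible

φ×[3,3]≡4 : PhiTimes 3 3 4
φ×[3,3]≡4 =
  (P₄ , P₄ , (P₄-connected , P₄-connected , 2≤4 , 2≤4 , P₄-Grundy , P₄-Grundy) ,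
   P₄×P₄-colouring , λ m γ → P₄×P₄-colours≤4 γ) ,
  λ G H admissible m → ×-Grundy[3,3]≥4 admissible
  where
  2≤4 : 2 ≤ 4
  2≤4 = s≤s (s≤s z≤n)

corollary38 : ((k : ℕ) → k ≥ 2 → PhiTimes k 2 k) × PhiTimes 3 3 4
corollary38 = φ×[k,2]≡k , φ×[3,3]≡4
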